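{- Let $p$ be a prime and let $f(x)=\sum_{m=0}^{\infty}B_m\chi(m,x):\mathbb{Z}_p\to\mathbb{Z}_p$ be a 1-Lipschitz function in van der Put expansion. Then for all $n\ge2$, $$\sum_{m=p^{n-1}}^{p^n-1}B_m=\sum_{m=0}^{p^n-1}f(m)-p\sum_{m=0}^{p^{n-1}-1}f(m).$$
   Context: $\mathbb{Z}_p$ is the ring of $p$-adic integers with absolute value $|x|_p=p^{ -\mathrm{ord}(x)}$. A function $f:\mathbb{Z}_p\to\mathbb{Z}_p$ is 1-Lipschitz if $|f(x)-f(y)|_p\le|x-y|_p$ for all $x,y$. For an integer $m>0$ with base-$p$ expansion $m=m_0+m_1p+\dots+m_sp^s$ ($0\le m_i\le p-1$, $m_s\ne0$), put $q(m)=m_sp^s$. The van der Put basis is: for $m>0$, $\chi(m,x)=1$ if $|x-m|_p\le p^{ -\lfloor\log_p m\rfloor-1}$ and $0$ otherwise; $\chi(0,x)=1$ if $|x|_p\le p^{ -1}$ and $0$ otherwise. Every continuous $f:\mathbb{Z}_p\to\mathbb{Z}_p$ has a unique expansion $f(x)=\sum_{m\ge0}B_m\chi(m,x)$ with $B_m\in\mathbb{Z}_p$, where $B_m=f(m)$ for $0\le m\le p-1$ and $B_m=f(m)-f(m-q(m))$ for $m\ge p$. -}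

module Defs where

open import Data.Nat as ℕ using (ℕ; zero; suc; _^_; _<?_; _∸_; NonZero)
open import Data.Nat.DivMod using (_/_)
open import Data.Integer as ℤ using (ℤ; +_; _+_; _-_; _*_)
open import Data.Integer.Divisibility.Signed using (_∣_; divides; ∣m∣n⇒∣m+n; ∣n⇒∣m*n; ∣m∣n⇒∣m-n)
open import Data.Integer.Solver using (module +-*-Solver)
open import Relation.Nullary using (yes; no)
open import Relation.Binary.PropositionalEquality using (_≡_; refl; subst; sym)

open +-*-Solver

-- The p-adic integers ℤ_p, modelled as coherent sequences of integer
-- approximations: x = lim x_k with x_{k+1} ≡ x_k (mod p^k).
-- Two such sequences represent the same p-adic integer iff they agree
-- modulo p^k at every level k (the setoid equality _≈_ below).

record ℤ[_] (p : ℕ) : Set where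
  constructor mkℤp
  field
    seq : ℕ → ℤ
    coh : ∀ k → + (p ^ k) ∣ (seq (suc k) - seq k)
open ℤ[_] public

module _ {p : ℕ} where

  infixl 6 _+ₚ_ _-ₚ_
  _+ₚ_ : ℤ[ p ] → ℤ[ p ] → ℤ[ p ]
  x +ₚ y = mkℤp (λ k → seq x k + seq y k) λ k →
    subst (+ (p ^ k) ∣_)
      (solve 4 (λ a a' b b' → (a' :- a) :+ (b' :- b) := (a' :+ b') :- (a :+ b))
             refl (seq x k) (seq x (suc k)) (seq y k) (seq y (suc k)))
      (∣m∣n⇒∣m+n (coh x k) (coh y k))

  _-ₚ_ : ℤ[ p ] → ℤ[ p ] → ℤ[ p ]
  x -ₚ y = mkℤp (λ k → seq x k - seq y k) λ k →
    subst (+ (p ^ k) ∣_)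
      (solve 4 (λ a a' b b' → (a' :- a) :- (b' :- b) := (a' :- b') :- (a :- b))
             refl (seq x k) (seq x (suc k)) (seq y k) (seq y (suc k)))
      (∣m∣n⇒∣m-n (coh x k) (coh y k))

  _·ₚ_ : ℤ → ℤ[ p ] → ℤ[ p ]
  c ·ₚ x = mkℤp (λ k → c * seq x k) λ k →
    subst (+ (p ^ k) ∣_)
      (solve 3 (λ c a a' → c :* (a' :- a) := (c :* a') :- (c :* a))
             refl c (seq x k) (seq x (suc k)))
      (∣n⇒∣m*n c (coh x k))

  ι : ℕ → ℤ[ p ]
  ι m = mkℤp (λ _ → + m) λ k →
    divides (+ 0) (solve 2 (λ a b → a :- a := con (+ 0) :* b) refl (+ m) (+ (p ^ k)))

  0ₚ : ℤ[ p ]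
  0ₚ = ι 0

  _∣ₚ_ : ℕ → ℤ[ p ] → Set
  k ∣ₚ z = + (p ^ k) ∣ seq z k

  infix 4 _≈ₚ_
  _≈ₚ_ : ℤ[ p ] → ℤ[ p ] → Set
  x ≈ₚ y = ∀ k → k ∣ₚ (x -ₚ y)

  OneLipschitz : (ℤ[ p ] → ℤ[ p ]) → Set
  OneLipschitz f = ∀ x y k → k ∣ₚ (x -ₚ y) → k ∣ₚ (f x -ₚ f y)

  Σ< : ℕ → (ℕ → ℤ[ p ]) → ℤ[ p ]
  Σ< zero    g = 0ₚ
  Σ< (suc n) g = Σ< n g +ₚ g n

  Σ[_⋯_⟩ : ℕ → ℕ → (ℕ → ℤ[ p ]) → ℤ[ p ]
  Σ[ a ⋯ b ⟩ g = Σ< (b ∸ a) (λ i → g (a ℕ.+ i))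

module _ (p : ℕ) .{{_ : NonZero p}} where

  -- q(m) = m_s p^s, the leading term of the base-p expansion of m > 0
  -- (computed as: q(m) = m if m < p, else q(m) = p · q(⌊m/p⌋); the fuel
  -- argument is only for termination and m is always sufficient fuel)
  qAux : ℕ → ℕ → ℕ
  qAux zero    m = m
  qAux (suc t) m with m <? p
  ... | yes _ = m
  ... | no  _ = p ℕ.* qAux t (m / p)

  q : ℕ → ℕ
  q m = qAux m m

  vdP : (ℤ[ p ] → ℤ[ p ]) → ℕ → ℤ[ p ]
  vdP f m with m <? p
  ... | yes _ = f (ι m)
  ... | no  _ = f (ι m) -ₚ f (ι (m ∸ q m))

{-# OPTIONS --safe #-}
-- Cut [p^{n-1}, p^n) into the p - 1 blocks d·p^{n-1} + [0, p^{n-1}), 1 ≤ d < p. On such a block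
-- q(m) = d·p^{n-1}, so m - q(m) runs once through [0, p^{n-1}) and B_m = f(m) - f(m - q(m)).
-- Summing, the terms f(m) give Σ_{p^{n-1} ≤ m < p^n} f(m), and the terms f(m - q(m)) give
-- (p - 1) Σ_{m < p^{n-1}} f(m). The identity holds exactly in every approximation level of ℤ_p.
module Submission where

open import Defs
open import Data.Nat
  using (ℕ; zero; suc; _+_; _*_; _∸_; _^_; _≤_; _<_; _<?_; z≤n; s≤s; NonZero; >-nonZero)
open import Data.Nat.Primality using (Prime)
open import Data.Nat.Properties
open import Data.Nat.DivMod using (_/_; m*n/n≡m; /-monoˡ-≤; m<n*o⇒m/o<n)
open import Data.Nat.Solver using (module +-*-Solver)
open import Data.Integer as ℤ using (ℤ; +_)
import Data.Integer.Properties as ℤ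
import Data.Integer.Solver as ℤ-Solver
open import Data.Integer.Divisibility.Signed using (divides)
open import Relation.Nullary using (yes; no; contradiction)
open import Relation.Binary.PropositionalEquality

n<m^n : ∀ {m} → 1 < m → ∀ n → n < m ^ n
n<m^n 1<m zero    = s≤s z≤n
n<m^n 1<m (suc n) = ≤-<-trans (n<m^n 1<m n) (^-monoʳ-< _ 1<m (n<1+n n))

module _ (p : ℕ) .{{_ : NonZero p}} where

  qAux-below : ∀ t {m} → m < p → qAux p t m ≡ m
  qAux-below zero        _   = refl
  qAux-below (suc t) {m} m<p with m <? p
  ... | yes _   = refl
  ... | no  m≮p = contradiction m<p m≮p

  qAux-above : ∀ t {m} → p ≤ m → qAux p (suc t) m ≡ p * qAux p t (m / p)
  qAux-above t {m} p≤m with m <? p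
  ... | yes m<p = contradiction p≤m (<⇒≱ m<p)
  ... | no  _   = refl

  qAux-leading : ∀ j {t m d} → j ≤ t → 0 < d → d < p →
                 d * p ^ j ≤ m → m < suc d * p ^ j → qAux p t m ≡ d * p ^ j
  qAux-leading zero {t} {m} {d} _ _ d<p lo hi = begin
      qAux p t m ≡⟨ qAux-below t (≤-<-trans (≤-pred hi′) d<p) ⟩
      m          ≡⟨ ≤-antisym (≤-pred hi′) lo′ ⟩
      d          ≡⟨ *-identityʳ d ⟨
      d * 1      ∎
    where
      open ≡-Reasoning
      lo′ : d ≤ m
      lo′ = subst (_≤ m) (*-identityʳ d) lo
      hi′ : m < suc d
      hi′ = subst (m <_) (*-identityʳ (suc d)) hi
  qAux-leading (suc j) {suc t} {m} {d} (s≤s j≤t) 0<d d<p lo hi = begin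
      qAux p (suc t) m     ≡⟨ qAux-above t p≤m ⟩
      p * qAux p t (m / p) ≡⟨ cong (p *_) (qAux-leading j j≤t 0<d d<p lo′ hi′) ⟩
      p * (d * p ^ j)      ≡⟨ x*[y*z]≡y*[x*z] p d (p ^ j) ⟩
      d * (p * p ^ j)      ∎
    where
      open ≡-Reasoning
      open +-*-Solver
      x*[y*z]≡y*[x*z] : ∀ x y z → x * (y * z) ≡ y * (x * z)
      x*[y*z]≡y*[x*z] = solve 3 (λ x y z → x :* (y :* z) := y :* (x :* z)) refl
      x*[y*z]≡x*z*y : ∀ x y z → x * (y * z) ≡ x * z * y
      x*[y*z]≡x*z*y = solve 3 (λ x y z → x :* (y :* z) := x :* z :* y) refl
      p≤m : p ≤ m
      p≤m = ≤-trans (m≤m*n p (p ^ j) {{m^n≢0 p j}})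
              (≤-trans (m≤n*m (p * p ^ j) d {{>-nonZero 0<d}}) lo)
      lo′ : d * p ^ j ≤ m / p
      lo′ = subst (_≤ m / p) (m*n/n≡m (d * p ^ j) p)
              (/-monoˡ-≤ p (subst (_≤ m) (x*[y*z]≡x*z*y d p (p ^ j)) lo))
      hi′ : m / p < suc d * p ^ j
      hi′ = m<n*o⇒m/o<n (subst (m <_) (x*[y*z]≡x*z*y (suc d) p (p ^ j)) hi)

  q-leading : 1 < p → ∀ j {d r} → 0 < d → d < p → r < p ^ j → q p (d * p ^ j + r) ≡ d * p ^ j
  q-leading 1<p j {d} {r} 0<d d<p r<pʲ =
    qAux-leading j fuel 0<d d<p (m≤m+n (d * p ^ j) r) below-next
    where
      fuel : j ≤ d * p ^ j + r
      fuel = ≤-trans (<⇒≤ (n<m^n 1<p j))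
               (≤-trans (m≤n*m (p ^ j) d {{>-nonZero 0<d}}) (m≤m+n (d * p ^ j) r))
      below-next : d * p ^ j + r < suc d * p ^ j
      below-next = subst (d * p ^ j + r <_) (+-comm (d * p ^ j) (p ^ j))
                     (+-monoʳ-< (d * p ^ j) r<pʲ)

  seq-vdP-above : ∀ f {m} → p ≤ m → ∀ k →
                  seq (vdP p f m) k ≡ seq (f (ι m)) k ℤ.- seq (f (ι (m ∸ q p m))) k
  seq-vdP-above f {m} p≤m k with m <? p
  ... | yes m<p = contradiction p≤m (<⇒≱ m<p)
  ... | no  _   = refl

Σℤ< : ℕ → (ℕ → ℤ) → ℤ
Σℤ< zero    a = + 0
Σℤ< (suc n) a = Σℤ< n a ℤ.+ a n

seq-Σ< : ∀ {p} n (g : ℕ → ℤ[ p ]) k → seq (Σ< n g) k ≡ Σℤ< n (λ i → seq (g i) k)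
seq-Σ< zero    g k = refl
seq-Σ< (suc n) g k = cong (ℤ._+ seq (g n) k) (seq-Σ< n g k)

Σℤ<-cong : ∀ n {a b} → (∀ i → i < n → a i ≡ b i) → Σℤ< n a ≡ Σℤ< n b
Σℤ<-cong zero    a≡b = refl
Σℤ<-cong (suc n) a≡b =
  cong₂ ℤ._+_ (Σℤ<-cong n (λ i i<n → a≡b i (m<n⇒m<1+n i<n))) (a≡b n (n<1+n n))

Σℤ<-split : ∀ m n a → Σℤ< (m + n) a ≡ Σℤ< m a ℤ.+ Σℤ< n (λ i → a (m + i))
Σℤ<-split m zero    a = trans (cong (λ l → Σℤ< l a) (+-identityʳ m)) (sym (ℤ.+-identityʳ _))
Σℤ<-split m (suc n) a = begin
    Σℤ< (m + suc n) a                                       ≡⟨ cong (λ l → Σℤ< l a) (+-suc m n) ⟩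
    Σℤ< (m + n) a ℤ.+ a (m + n)                             ≡⟨ cong (ℤ._+ a (m + n)) (Σℤ<-split m n a) ⟩
    Σℤ< m a ℤ.+ Σℤ< n (λ i → a (m + i)) ℤ.+ a (m + n)       ≡⟨ ℤ.+-assoc (Σℤ< m a) _ _ ⟩
    Σℤ< m a ℤ.+ (Σℤ< n (λ i → a (m + i)) ℤ.+ a (m + n))     ∎
  where open ≡-Reasoning

Σℤ<-distrib-- : ∀ n a b → Σℤ< n (λ i → a i ℤ.- b i) ≡ Σℤ< n a ℤ.- Σℤ< n b
Σℤ<-distrib-- zero    a b = refl
Σℤ<-distrib-- (suc n) a b =
  trans (cong (ℤ._+ (a n ℤ.- b n)) (Σℤ<-distrib-- n a b))
        (x-y+[u-v]≡x+u-[y+v] (Σℤ< n a) (Σℤ< n b) (a n) (b n))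
  where
    open ℤ-Solver.+-*-Solver
    x-y+[u-v]≡x+u-[y+v] : ∀ x y u v → x ℤ.- y ℤ.+ (u ℤ.- v) ≡ x ℤ.+ u ℤ.- (y ℤ.+ v)
    x-y+[u-v]≡x+u-[y+v] = solve 4 (λ x y u v → x :- y :+ (u :- v) := x :+ u :- (y :+ v)) refl

Σℤ<-periodic : ∀ c P {a b} → (∀ d r → d < c → r < P → a (d * P + r) ≡ b r) →
               Σℤ< (c * P) a ≡ + c ℤ.* Σℤ< P b
Σℤ<-periodic zero    P {b = b} _ = sym (ℤ.*-zeroˡ (Σℤ< P b))
Σℤ<-periodic (suc c) P {a} {b} a≡b = begin
    Σℤ< (P + c * P) a                                 ≡⟨ Σℤ<-split P (c * P) a ⟩
    Σℤ< P a ℤ.+ Σℤ< (c * P) (λ i → a (P + i))        ≡⟨ cong₂ ℤ._+_ first-block other-blocks ⟩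
    Σℤ< P b ℤ.+ + c ℤ.* Σℤ< P b                        ≡⟨ ℤ.suc-* (+ c) (Σℤ< P b) ⟨
    + suc c ℤ.* Σℤ< P b                                ∎
  where
    open ≡-Reasoning
    first-block : Σℤ< P a ≡ Σℤ< P b
    first-block = Σℤ<-cong P (λ r → a≡b 0 r (s≤s z≤n))
    other-blocks : Σℤ< (c * P) (λ i → a (P + i)) ≡ + c ℤ.* Σℤ< P b
    other-blocks = Σℤ<-periodic c P λ d r d<c r<P →
      trans (cong a (sym (+-assoc P (d * P) r))) (a≡b (suc d) r (s≤s d<c) r<P)

Σℤ<-leading-term-differences : ∀ c j (a : ℕ → ℤ) → let P = suc c ^ j in
  Σℤ< (suc c * P ∸ P) (λ i → a (P + i) ℤ.- a (P + i ∸ q (suc c) (P + i)))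
    ≡ Σℤ< (suc c * P) a ℤ.- + suc c ℤ.* Σℤ< P a
Σℤ<-leading-term-differences c j a = begin
    Σℤ< (P + c * P ∸ P) differences
  ≡⟨ cong (λ l → Σℤ< l differences) (m+n∸m≡n P (c * P)) ⟩
    Σℤ< (c * P) differences
  ≡⟨ Σℤ<-distrib-- (c * P) (λ i → a (P + i)) (λ i → a (P + i ∸ q p (P + i))) ⟩
    Σℤ< (c * P) (λ i → a (P + i)) ℤ.- Σℤ< (c * P) (λ i → a (P + i ∸ q p (P + i)))
  ≡⟨ cong (λ s → Σℤ< (c * P) (λ i → a (P + i)) ℤ.- s) (Σℤ<-periodic c P drop-leading-term) ⟩
    Σℤ< (c * P) (λ i → a (P + i)) ℤ.- + c ℤ.* Σℤ< P a
  ≡⟨ x-c*y≡y+x-[1+c]*y (Σℤ< P a) (Σℤ< (c * P) (λ i → a (P + i))) (+ c) ⟩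
    Σℤ< P a ℤ.+ Σℤ< (c * P) (λ i → a (P + i)) ℤ.- + suc c ℤ.* Σℤ< P a
  ≡⟨ cong (ℤ._- + suc c ℤ.* Σℤ< P a) (Σℤ<-split P (c * P) a) ⟨
    Σℤ< (P + c * P) a ℤ.- + suc c ℤ.* Σℤ< P a
  ∎
  where
    open ≡-Reasoning
    open ℤ-Solver.+-*-Solver
    p = suc c
    P = p ^ j
    differences : ℕ → ℤ
    differences i = a (P + i) ℤ.- a (P + i ∸ q p (P + i))
    x-c*y≡y+x-[1+c]*y : ∀ y x c → x ℤ.- c ℤ.* y ≡ y ℤ.+ x ℤ.- (+ 1 ℤ.+ c) ℤ.* y
    x-c*y≡y+x-[1+c]*y = solve 3 (λ y x c → x :- c :* y := y :+ x :- (con (+ 1) :+ c) :* y) refl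
    drop-leading-term : ∀ d r → d < c → r < P → a (P + (d * P + r) ∸ q p (P + (d * P + r))) ≡ a r
    drop-leading-term d r d<c r<P = cong a (begin
        P + (d * P + r) ∸ q p (P + (d * P + r)) ≡⟨ cong (λ m → m ∸ q p m) (+-assoc P (d * P) r) ⟨
        suc d * P + r ∸ q p (suc d * P + r)     ≡⟨ cong (suc d * P + r ∸_) (q-leading p 1<p j (s≤s z≤n) (s≤s d<c) r<P) ⟩
        suc d * P + r ∸ suc d * P               ≡⟨ m+n∸m≡n (suc d * P) r ⟩
        r                                       ∎)
      where
        1<p : 1 < p
        1<p = s≤s (≤-trans (s≤s z≤n) d<c)

≈ₚ-from-levels : ∀ {p} {x y : ℤ[ p ]} → (∀ k → seq x k ≡ seq y k) → x ≈ₚ y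
≈ₚ-from-levels {p} {x} {y} x≡y k = divides (+ 0) (begin
    seq x k ℤ.- seq y k ≡⟨ cong (ℤ._- seq y k) (x≡y k) ⟩
    seq y k ℤ.- seq y k ≡⟨ ℤ.+-inverseʳ (seq y k) ⟩
    + 0                 ≡⟨ ℤ.*-zeroˡ (+ (p ^ k)) ⟨
    + 0 ℤ.* + (p ^ k)   ∎)
  where open ≡-Reasoning

lemma3p9 : (p : ℕ) .{{_ : NonZero p}} → Prime p →
    (f : ℤ[ p ] → ℤ[ p ]) → OneLipschitz f →
    (n : ℕ) → 2 ≤ n →
    Σ[ p ^ (n ∸ 1) ⋯ p ^ n ⟩ (vdP p f)
      ≈ₚ Σ< (p ^ n) (λ m → f (ι m)) -ₚ (+ p) ·ₚ Σ< (p ^ (n ∸ 1)) (λ m → f (ι m))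
lemma3p9 zero {{()}}
lemma3p9 p@(suc c) _ f _ (suc (suc j)) (s≤s (s≤s z≤n)) = ≈ₚ-from-levels {x = lhs} {y = rhs} λ k → begin
    seq lhs k
  ≡⟨ seq-Σ< (p * P ∸ P) (λ i → vdP p f (P + i)) k ⟩
    Σℤ< (p * P ∸ P) (λ i → seq (vdP p f (P + i)) k)
  ≡⟨ Σℤ<-cong (p * P ∸ P) (λ i _ → seq-vdP-above p f (≤-trans p≤P (m≤m+n P i)) k) ⟩
    Σℤ< (p * P ∸ P) (λ i → seq (f (ι (P + i))) k ℤ.- seq (f (ι (P + i ∸ q p (P + i)))) k)
  ≡⟨ Σℤ<-leading-term-differences c (suc j) (λ m → seq (f (ι m)) k) ⟩
    Σℤ< (p * P) (λ m → seq (f (ι m)) k) ℤ.- + p ℤ.* Σℤ< P (λ m → seq (f (ι m)) k)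
  ≡⟨ cong₂ (λ x y → x ℤ.- + p ℤ.* y) (seq-Σ< (p * P) _ k) (seq-Σ< P _ k) ⟨
    seq rhs k
  ∎
  where
    open ≡-Reasoning
    P = p ^ suc j
    lhs rhs : ℤ[ p ]
    lhs = Σ[ P ⋯ p * P ⟩ (vdP p f)
    rhs = Σ< (p * P) (λ m → f (ι m)) -ₚ (+ p) ·ₚ Σ< P (λ m → f (ι m))
    p≤P : p ≤ P
    p≤P = m≤m*n p (p ^ j) {{m^n≢0 p j}}
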